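{- There exists a numerical semigroup $S$ that is $+ + -$ avoiding and has matricial dimension greater than $2$. In particular, it is false that every numerical semigroup all of whose nonzero small elements are lonely is dimension-$2$ realizable.
   Context: $\mathbb{N}=\{0,1,2,\ldots\}$. A numerical semigroup is an additive submonoid of $\mathbb{N}$ with finite complement; its Frobenius number $g(S)$ is the largest integer not in $S$, and its nonzero small elements are the $n\in S\setminus\{0\}$ with $n<g(S)$. Such an $n$ is lonely if $n-1\notin S$ and $n+1\notin S$. $S$ is $+ + -$ avoiding if $n,n+1\in S$ implies $n+2\in S$. For $A\in\mathrm{M}_d(\mathbb{Q})$, $\mathcal{S}(A)=\{n\in\mathbb{N}: A^n\in\mathrm{M}_d(\mathbb{Z})\}$. The matricial dimension of $S$ is the least $d\geq 1$ with $S=\mathcal{S}(A)$ for some $A\in\mathrm{M}_d(\mathbb{Q})$; $S$ is dimension-$2$ realizable iff its matricial dimension is at most $2$. -}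

module Defs where

open import Data.Nat using (ℕ; zero; suc; _+_; _<_; _≤_)
open import Data.Fin using (Fin; _≟_)
open import Data.Rational using (ℚ; 0ℚ; 1ℚ; ↧ₙ_) renaming (_+_ to _+ℚ_; _*_ to _*ℚ_)
open import Data.Product using (Σ; _×_; ∃)
open import Data.Empty using (⊥)
open import Relation.Nullary using (¬_; yes; no)
open import Relation.Binary.PropositionalEquality using (_≡_; _≢_)
open import Function.Bundles using (_⇔_)

SubsetOfℕ : Set₁
SubsetOfℕ = ℕ → Set

record IsNumericalSemigroup (S : SubsetOfℕ) : Set where
  field
    zero∈ : S 0
    +-closed : ∀ m n → S m → S n → S (m + n)
    cofinite : Σ ℕ λ N → ∀ n → N ≤ n → S n

PPMAvoiding : SubsetOfℕ → Set
PPMAvoiding S = ∀ n → S n → S (suc n) → S (suc (suc n))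

-- n < g(S), g(S) the Frobenius number (largest non-element), unfolded:
-- there is a non-element of S larger than n.
BelowFrobenius : SubsetOfℕ → ℕ → Set
BelowFrobenius S n = Σ ℕ λ m → n < m × ¬ S m

NonzeroSmall : SubsetOfℕ → ℕ → Set
NonzeroSmall S n = S n × n ≢ 0 × BelowFrobenius S n

-- lonely element: n-1 ∉ S and n+1 ∉ S (only used for n ≠ 0, so n = suc k)
Lonely : SubsetOfℕ → ℕ → Set
Lonely S zero = ¬ S 1
Lonely S (suc k) = ¬ S k × ¬ S (suc (suc k))

AllNonzeroSmallLonely : SubsetOfℕ → Set
AllNonzeroSmallLonely S = ∀ n → NonzeroSmall S n → Lonely S n

Mat : ℕ → Set
Mat d = Fin d → Fin d → ℚ

sumFin : (d : ℕ) → (Fin d → ℚ) → ℚ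
sumFin zero f = 0ℚ
sumFin (suc d) f = f Fin.zero +ℚ sumFin d (λ i → f (Fin.suc i))

_⊗_ : {d : ℕ} → Mat d → Mat d → Mat d
_⊗_ {d} A B i j = sumFin d (λ k → A i k *ℚ B k j)

idMat : (d : ℕ) → Mat d
idMat d i j with i ≟ j
... | yes _ = 1ℚ
... | no _ = 0ℚ

matPow : {d : ℕ} → Mat d → ℕ → Mat d
matPow {d} A zero = idMat d
matPow {d} A (suc n) = A ⊗ matPow A n

IsIntegerℚ : ℚ → Set
IsIntegerℚ q = ↧ₙ q ≡ 1

IsIntegerMat : {d : ℕ} → Mat d → Set
IsIntegerMat {d} A = ∀ i j → IsIntegerℚ (A i j)

Realizes : {d : ℕ} → Mat d → SubsetOfℕ → Set
Realizes A S = ∀ n → S n ⇔ IsIntegerMat (matPow A n)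

MatDimAtMost : ℕ → SubsetOfℕ → Set
MatDimAtMost k S = Σ ℕ λ d → 1 ≤ d × d ≤ k × Σ (Mat d) λ A → Realizes A S

Dim2Realizable : SubsetOfℕ → Set
Dim2Realizable = MatDimAtMost 2

-- S = {0, 5, 7, 10, 12} ∪ [14, ∞) is + + − avoiding, its nonzero small elements 5, 7, 10, 12
-- are lonely, and 9 ∉ S; we show that no A ∈ M_d(ℚ) with d ≤ 2 has A⁵ and A⁷ integral but
-- A⁹ not.  For d = 2 let t = tr A and δ = det A.  Then det(A⁵) = δ⁵, and t is a root of the
-- monic polynomial x⁵ − 5δx³ + 5δ²x − tr(A⁵), so by the rational root theorem δ and then t are
-- integers.  Cayley–Hamilton gives A⁴ = (t² − 2δ)A² − δ², hence A⁹ = (t² − 2δ)A⁷ − δ²A⁵ is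
-- integral.  The case d = 1 is the rational root theorem for x⁵ − A⁵.
module Submission where

open import Defs
open import Data.Product using (Σ; _×_; _,_)
open import Relation.Nullary using (¬_)

open import Data.Empty using (⊥-elim)
open import Data.Fin using () renaming (zero to 0F; suc to sucF)
open import Data.Integer as ℤ using (ℤ; +_; 0ℤ; 1ℤ)
import Data.Integer.Properties as ℤ
open import Data.Integer.Tactic.RingSolver using (solve-∀)
open import Data.List using (List; []; _∷_; length; replicate)
open import Data.List.Relation.Unary.All using (All; []; _∷_)
open import Data.List.Relation.Unary.All.Properties using (replicate⁺)
open import Data.Nat as ℕ using (ℕ; zero; suc; _≤_; s≤s)
import Data.Nat.Properties as ℕ
open import Data.Nat.Coprimality as Coprimality using (Coprime; coprime-divisor)
open import Data.Nat.Divisibility using (_∣_; divides; ∣1⇒≡1)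
open import Data.Rational using (ℚ; mkℚ; 0ℚ; 1ℚ; _+_; _*_; _-_; -_; ↥_; _/_)
import Data.Rational.Properties as ℚ
open import Data.Rational.Solver using (module +-*-Solver)
open import Algebra.Definitions.RawSemiring Data.Rational.+-*-rawSemiring using (_^_)
import Data.Rational.Unnormalised.Base as ℚᵘ
open import Function.Bundles using (Equivalence)
open import Relation.Binary.PropositionalEquality
  using (_≡_; refl; sym; trans; cong; cong₂; subst; module ≡-Reasoning)
open import Relation.Nullary.Decidable using (recompute)

open +-*-Solver using (solve; Polynomial; con; _:+_; _:*_; _:-_; :-_; _:=_)

data S : ℕ → Set where
  0∈S  : S 0
  5∈S  : S 5
  7∈S  : S 7
  10∈S : S 10
  12∈S : S 12
  14+_∈S : ∀ k → S (14 ℕ.+ k)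

≥14⇒∈S : ∀ {n} → 14 ≤ n → S n
≥14⇒∈S 14≤n = subst S (ℕ.m+[n∸m]≡n 14≤n) (14+ _ ∈S)

S-+ : ∀ {m n} → S m → S n → S (m ℕ.+ n)
S-+ 0∈S         y            = y
S-+ (14+ k ∈S)  _            = 14+ _ ∈S
S-+ 5∈S         0∈S          = 5∈S
S-+ 5∈S         5∈S          = 10∈S
S-+ 5∈S         7∈S          = 12∈S
S-+ 5∈S         10∈S         = 14+ _ ∈S
S-+ 5∈S         12∈S         = 14+ _ ∈S
S-+ 5∈S         (14+ k ∈S)   = 14+ _ ∈S
S-+ 7∈S         0∈S          = 7∈S
S-+ 7∈S         5∈S          = 12∈S
S-+ 7∈S         7∈S          = 14+ _ ∈S
S-+ 7∈S         10∈S         = 14+ _ ∈S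
S-+ 7∈S         12∈S         = 14+ _ ∈S
S-+ 7∈S         (14+ k ∈S)   = 14+ _ ∈S
S-+ 10∈S        0∈S          = 10∈S
S-+ 10∈S        5∈S          = 14+ _ ∈S
S-+ 10∈S        7∈S          = 14+ _ ∈S
S-+ 10∈S        10∈S         = 14+ _ ∈S
S-+ 10∈S        12∈S         = 14+ _ ∈S
S-+ 10∈S        (14+ k ∈S)   = 14+ _ ∈S
S-+ 12∈S        0∈S          = 12∈S
S-+ 12∈S        5∈S          = 14+ _ ∈S
S-+ 12∈S        7∈S          = 14+ _ ∈S
S-+ 12∈S        10∈S         = 14+ _ ∈S
S-+ 12∈S        12∈S         = 14+ _ ∈S
S-+ 12∈S        (14+ k ∈S)   = 14+ _ ∈S

S-isNumericalSemigroup : IsNumericalSemigroup S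
S-isNumericalSemigroup = record
  { zero∈    = 0∈S
  ; +-closed = λ _ _ → S-+
  ; cofinite = 14 , λ _ → ≥14⇒∈S
  }

S-ppmAvoiding : PPMAvoiding S
S-ppmAvoiding _ (14+ k ∈S) _ = 14+ _ ∈S
S-ppmAvoiding _ 0∈S  ()
S-ppmAvoiding _ 5∈S  ()
S-ppmAvoiding _ 7∈S  ()
S-ppmAvoiding _ 10∈S ()
S-ppmAvoiding _ 12∈S ()

S-smallLonely : AllNonzeroSmallLonely S
S-smallLonely _ (0∈S  , 0≢0 , _) = ⊥-elim (0≢0 refl)
S-smallLonely _ (5∈S  , _) = (λ ()) , (λ ())
S-smallLonely _ (7∈S  , _) = (λ ()) , (λ ())
S-smallLonely _ (10∈S , _) = (λ ()) , (λ ())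
S-smallLonely _ (12∈S , _) = (λ ()) , (λ ())
S-smallLonely _ (14+ k ∈S , _ , _ , n<m , m∉S) =
  ⊥-elim (m∉S (≥14⇒∈S (ℕ.≤-trans (ℕ.m≤m+n 14 k) (ℕ.<⇒≤ n<m))))

-- i / 1, written in reduced form so that ↧ₙ (ι i) ≡ 1 holds definitionally.
ι : ℤ → ℚ
ι i = mkℚ i 0 (Coprimality.sym (Coprimality.1-coprimeTo ℤ.∣ i ∣))

/1≡ι : ∀ i → i / 1 ≡ ι i
/1≡ι i = ℚ.↥p/↧p≡p (ι i)

ι-+ : ∀ i j → ι i + ι j ≡ ι (i ℤ.+ j)
ι-+ i j = trans (cong (_/ 1) (cong₂ ℤ._+_ (ℤ.*-identityʳ i) (ℤ.*-identityʳ j))) (/1≡ι (i ℤ.+ j))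

ι-* : ∀ i j → ι i * ι j ≡ ι (i ℤ.* j)
ι-* i j = /1≡ι (i ℤ.* j)

ι-neg : ∀ i → - ι i ≡ ι (ℤ.- i)
ι-neg (+ zero)     = refl
ι-neg (+ suc n)    = refl
ι-neg ℤ.-[1+ n ]   = refl

-- A record, so that q can be inferred from Integral q (unlike from ↧ₙ q ≡ 1).
record Integral (q : ℚ) : Set where
  constructor integral
  field isInteger : IsIntegerℚ q

open Integral

ι-integral : ∀ i → Integral (ι i)
ι-integral i = integral refl

integral⇒≡ι : ∀ {q} → Integral q → q ≡ ι (↥ q)
integral⇒≡ι {mkℚ _ zero _}    (integral refl) = refl
integral⇒≡ι {mkℚ _ (suc _) _} (integral ())

≡ι⇒integral : ∀ {q i} → q ≡ ι i → Integral q
≡ι⇒integral {i = i} q≡ι = subst Integral (sym q≡ι) (ι-integral i)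

integral-+ : ∀ {p q} → Integral p → Integral q → Integral (p + q)
integral-+ {p} {q} ip iq =
  ≡ι⇒integral (trans (cong₂ _+_ (integral⇒≡ι ip) (integral⇒≡ι iq)) (ι-+ (↥ p) (↥ q)))

integral-* : ∀ {p q} → Integral p → Integral q → Integral (p * q)
integral-* {p} {q} ip iq =
  ≡ι⇒integral (trans (cong₂ _*_ (integral⇒≡ι ip) (integral⇒≡ι iq)) (ι-* (↥ p) (↥ q)))

integral-neg : ∀ {q} → Integral q → Integral (- q)
integral-neg iq = ≡ι⇒integral (trans (cong -_ (integral⇒≡ι iq)) (ι-neg _))

integral-- : ∀ {p q} → Integral p → Integral q → Integral (p - q)
integral-- ip iq = integral-+ ip (integral-neg iq)

integral-^ : ∀ {q} → Integral q → ∀ n → Integral (q ^ n)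
integral-^ iq zero    = ι-integral 1ℤ
integral-^ iq (suc n) = integral-* iq (integral-^ iq n)

-- monic (c₀ ∷ c₁ ∷ … ∷ cₙ₋₁ ∷ []) x = c₀ + c₁ x + … + cₙ₋₁ xⁿ⁻¹ + xⁿ
monic : List ℚ → ℚ → ℚ
monic []       x = 1ℚ
monic (c ∷ cs) x = c + x * monic cs x

∣i^n∣≡∣i∣^n : ∀ i n → ℤ.∣ i ℤ.^ n ∣ ≡ ℤ.∣ i ∣ ℕ.^ n
∣i^n∣≡∣i∣^n i zero    = refl
∣i^n∣≡∣i∣^n i (suc n) = trans (ℤ.abs-* i (i ℤ.^ n)) (cong (ℤ.∣ i ∣ ℕ.*_) (∣i^n∣≡∣i∣^n i n))

coprime-∣^⇒∣1 : ∀ {s a} n → Coprime s a → s ∣ a ℕ.^ n → s ∣ 1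
coprime-∣^⇒∣1 zero    s⊥a s∣1   = s∣1
coprime-∣^⇒∣1 (suc n) s⊥a s∣aⁿ⁺¹ = coprime-∣^⇒∣1 n s⊥a (coprime-divisor s⊥a s∣aⁿ⁺¹)

-- Writing q = r / s in lowest terms, sⁿ · monic cs q ≡ rⁿ (mod s), so a root forces
-- s ∣ rⁿ and hence s ∣ 1.
monicRoot⇒integral : ∀ {cs q} → All Integral cs → monic cs q ≡ 0ℚ → Integral q
monicRoot⇒integral {cs} {q@(mkℚ r k r⊥s)} ics root =
  integral (∣1⇒≡1 (coprime-∣^⇒∣1 (length cs) s⊥r s∣rⁿ))
  where
  s : ℕ
  s = suc k

  σ : ℤ
  σ = + s

  s⊥r : Coprime s ℤ.∣ r ∣
  s⊥r = Coprimality.sym (recompute (Coprimality.coprime? ℤ.∣ r ∣ s) r⊥s)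

  qσ≡r : q * ι σ ≡ ι r
  qσ≡r = trans (ℚ.fromℚᵘ-cong {ℚᵘ.mkℚᵘ (r ℤ.* σ) (k ℕ.* 1)} {ℚᵘ.mkℚᵘ r 0} (ℚᵘ.*≡* rσ≡rs))
               (/1≡ι r)
    where
    rσ≡rs : r ℤ.* σ ℤ.* + 1 ≡ r ℤ.* + suc (k ℕ.* 1)
    rσ≡rs rewrite ℕ.*-identityʳ k = ℤ.*-identityʳ (r ℤ.* σ)

  cleared : ∀ {cs} → All Integral cs →
            Σ ℤ λ m → ι (σ ℤ.^ length cs) * monic cs q ≡ ι (r ℤ.^ length cs ℤ.+ σ ℤ.* m)
  cleared [] = 0ℤ , trans (ℚ.*-identityʳ (ι 1ℤ)) (cong (λ z → ι (1ℤ ℤ.+ z)) (sym (ℤ.*-zeroʳ σ)))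
  cleared {c ∷ cs} (ic ∷ ics) with cleared ics
  ... | m , IH = σⁿ ℤ.* ↥ c ℤ.+ r ℤ.* m , (begin
      ι (σ ℤ.* σⁿ) * (c + q * P)
        ≡⟨ cong (_* (c + q * P)) (sym (ι-* σ σⁿ)) ⟩
      ι σ * ι σⁿ * (c + q * P)
        ≡⟨ solve 5 (λ a b c q P → a :* b :* (c :+ q :* P) := a :* b :* c :+ q :* a :* (b :* P))
                 refl (ι σ) (ι σⁿ) c q P ⟩
      ι σ * ι σⁿ * c + q * ι σ * (ι σⁿ * P)
        ≡⟨ cong₂ _+_ (cong (ι σ * ι σⁿ *_) (integral⇒≡ι ic)) (cong₂ _*_ qσ≡r IH) ⟩
      ι σ * ι σⁿ * ι (↥ c) + ι r * ι (rⁿ ℤ.+ σ ℤ.* m)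
        ≡⟨ cong₂ _+_ (trans (cong (_* ι (↥ c)) (ι-* σ σⁿ)) (ι-* (σ ℤ.* σⁿ) (↥ c))) (ι-* r _) ⟩
      ι (σ ℤ.* σⁿ ℤ.* ↥ c) + ι (r ℤ.* (rⁿ ℤ.+ σ ℤ.* m))
        ≡⟨ ι-+ (σ ℤ.* σⁿ ℤ.* ↥ c) (r ℤ.* (rⁿ ℤ.+ σ ℤ.* m)) ⟩
      ι (σ ℤ.* σⁿ ℤ.* ↥ c ℤ.+ r ℤ.* (rⁿ ℤ.+ σ ℤ.* m))
        ≡⟨ cong ι (regroup σ σⁿ (↥ c) r rⁿ m) ⟩
      ι (r ℤ.* rⁿ ℤ.+ σ ℤ.* (σⁿ ℤ.* ↥ c ℤ.+ r ℤ.* m)) ∎)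
    where
    open ≡-Reasoning
    P = monic cs q
    σⁿ = σ ℤ.^ length cs
    rⁿ = r ℤ.^ length cs
    regroup : ∀ a b c r x m → a ℤ.* b ℤ.* c ℤ.+ r ℤ.* (x ℤ.+ a ℤ.* m)
                              ≡ r ℤ.* x ℤ.+ a ℤ.* (b ℤ.* c ℤ.+ r ℤ.* m)
    regroup = solve-∀

  s∣rⁿ : s ∣ ℤ.∣ r ∣ ℕ.^ length cs
  s∣rⁿ with cleared ics
  ... | m , eq = divides ℤ.∣ ℤ.- m ∣ (begin
      ℤ.∣ r ∣ ℕ.^ n        ≡⟨ sym (∣i^n∣≡∣i∣^n r n) ⟩
      ℤ.∣ r ℤ.^ n ∣        ≡⟨ cong ℤ.∣_∣ rⁿ≡σ[-m] ⟩
      ℤ.∣ σ ℤ.* ℤ.- m ∣    ≡⟨ ℤ.abs-* σ (ℤ.- m) ⟩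
      s ℕ.* ℤ.∣ ℤ.- m ∣    ≡⟨ ℕ.*-comm s _ ⟩
      ℤ.∣ ℤ.- m ∣ ℕ.* s    ∎)
    where
    open ≡-Reasoning
    n = length cs
    rⁿ+σm≡0 : r ℤ.^ n ℤ.+ σ ℤ.* m ≡ 0ℤ
    rⁿ+σm≡0 = cong ↥_ (trans (sym eq) (trans (cong (ι (σ ℤ.^ n) *_) root) (ℚ.*-zeroʳ (ι (σ ℤ.^ n)))))
    sub-neg : ∀ x a m → x ℤ.- a ℤ.* ℤ.- m ≡ x ℤ.+ a ℤ.* m
    sub-neg = solve-∀
    rⁿ≡σ[-m] : r ℤ.^ n ≡ σ ℤ.* ℤ.- m
    rⁿ≡σ[-m] = ℤ.i-j≡0⇒i≡j (r ℤ.^ n) (σ ℤ.* ℤ.- m) (trans (sub-neg (r ℤ.^ n) σ m) rⁿ+σm≡0)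

monic-replicate-0 : ∀ n q → monic (replicate n 0ℚ) q ≡ q ^ n
monic-replicate-0 zero    q = refl
monic-replicate-0 (suc n) q = trans (ℚ.+-identityˡ _) (cong (q *_) (monic-replicate-0 n q))

integral-^⇒integral : ∀ {q} n → Integral (q ^ suc n) → Integral q
integral-^⇒integral {q} n iqⁿ⁺¹ =
  monicRoot⇒integral (integral-neg iqⁿ⁺¹ ∷ replicate⁺ n (ι-integral 0ℤ))
    (trans (cong (λ p → - (q ^ suc n) + q * p) (monic-replicate-0 n q)) (ℚ.+-inverseˡ (q ^ suc n)))

pattern 1F = sucF 0F

det : Mat 2 → ℚ
det A = A 0F 0F * A 1F 1F - A 0F 1F * A 1F 0F

trace : Mat 2 → ℚ
trace A = A 0F 0F + A 1F 1F

det-⊗ : ∀ A B → det (A ⊗ B) ≡ det A * det B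
det-⊗ A B = solve 8 (λ a b c e a′ b′ c′ e′ →
      (a :* a′ :+ (b :* c′ :+ con 0ℚ)) :* (c :* b′ :+ (e :* e′ :+ con 0ℚ))
        :- (a :* b′ :+ (b :* e′ :+ con 0ℚ)) :* (c :* a′ :+ (e :* c′ :+ con 0ℚ))
      := (a :* e :- b :* c) :* (a′ :* e′ :- b′ :* c′)) refl
  (A 0F 0F) (A 0F 1F) (A 1F 0F) (A 1F 1F) (B 0F 0F) (B 0F 1F) (B 1F 0F) (B 1F 1F)

det-pow : ∀ A n → det (matPow A n) ≡ det A ^ n
det-pow A zero    = refl
det-pow A (suc n) = trans (det-⊗ A (matPow A n)) (cong (det A *_) (det-pow A n))

⊗-identityʳ : ∀ (A : Mat 2) i j → (A ⊗ idMat 2) i j ≡ A i j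
⊗-identityʳ A i 0F = solve 2 (λ x y → x :* con 1ℚ :+ (y :* con 0ℚ :+ con 0ℚ) := x) refl (A i 0F) (A i 1F)
⊗-identityʳ A i 1F = solve 2 (λ x y → x :* con 0ℚ :+ (y :* con 1ℚ :+ con 0ℚ) := y) refl (A i 0F) (A i 1F)

⊗-affineʳ : ∀ (A B M : Mat 2) x y → (∀ k j → M k j ≡ x * B k j - y * idMat 2 k j) →
            ∀ i j → (A ⊗ M) i j ≡ x * (A ⊗ B) i j - y * (A ⊗ idMat 2) i j
⊗-affineʳ A B M x y M≡ i j rewrite M≡ 0F j | M≡ 1F j =
  solve 8 (λ a₀ a₁ b₀ b₁ e₀ e₁ x y →
      a₀ :* (x :* b₀ :- y :* e₀) :+ (a₁ :* (x :* b₁ :- y :* e₁) :+ con 0ℚ)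
      := x :* (a₀ :* b₀ :+ (a₁ :* b₁ :+ con 0ℚ)) :- y :* (a₀ :* e₀ :+ (a₁ :* e₁ :+ con 0ℚ))) refl
    (A i 0F) (A i 1F) (B 0F j) (B 1F j) (idMat 2 0F j) (idMat 2 1F j) x y

U : ℚ → ℚ → ℕ → ℚ
U t d zero          = 0ℚ
U t d (suc zero)    = 1ℚ
U t d (suc (suc n)) = t * U t d (suc n) - d * U t d n

-- The syntactic twin of U: ⟦ Uᴾ t d n ⟧ unfolds to U ⟦ t ⟧ ⟦ d ⟧ n for each numeral n,
-- which lets the ring solver see through U.
Uᴾ : ∀ {k} → Polynomial k → Polynomial k → ℕ → Polynomial k
Uᴾ t d zero          = con 0ℚ
Uᴾ t d (suc zero)    = con 1ℚ
Uᴾ t d (suc (suc n)) = t :* Uᴾ t d (suc n) :- d :* Uᴾ t d n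

module _ (A : Mat 2) where
  private
    t = trace A
    δ = det A

  cayley-hamilton : ∀ i j → (A ⊗ A) i j ≡ trace A * A i j - det A * idMat 2 i j
  cayley-hamilton 0F 0F = solve 4 (λ a b c e → a :* a :+ (b :* c :+ con 0ℚ)
    := (a :+ e) :* a :- (a :* e :- b :* c) :* con 1ℚ) refl (A 0F 0F) (A 0F 1F) (A 1F 0F) (A 1F 1F)
  cayley-hamilton 0F 1F = solve 4 (λ a b c e → a :* b :+ (b :* e :+ con 0ℚ)
    := (a :+ e) :* b :- (a :* e :- b :* c) :* con 0ℚ) refl (A 0F 0F) (A 0F 1F) (A 1F 0F) (A 1F 1F)
  cayley-hamilton 1F 0F = solve 4 (λ a b c e → c :* a :+ (e :* c :+ con 0ℚ)
    := (a :+ e) :* c :- (a :* e :- b :* c) :* con 0ℚ) refl (A 0F 0F) (A 0F 1F) (A 1F 0F) (A 1F 1F)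
  cayley-hamilton 1F 1F = solve 4 (λ a b c e → c :* b :+ (e :* e :+ con 0ℚ)
    := (a :+ e) :* e :- (a :* e :- b :* c) :* con 1ℚ) refl (A 0F 0F) (A 0F 1F) (A 1F 0F) (A 1F 1F)

  pow≡U : ∀ n i j → matPow A (suc n) i j ≡ U t δ (suc n) * A i j - δ * U t δ n * idMat 2 i j
  pow≡U zero i j = trans (⊗-identityʳ A i j)
    (solve 3 (λ x δ z → x := con 1ℚ :* x :- δ :* con 0ℚ :* z) refl (A i j) δ (idMat 2 i j))
  pow≡U (suc n) i j = begin
    (A ⊗ matPow A (suc n)) i j
      ≡⟨ ⊗-affineʳ A A (matPow A (suc n)) (U t δ (suc n)) (δ * U t δ n) (pow≡U n) i j ⟩
    U t δ (suc n) * (A ⊗ A) i j - δ * U t δ n * (A ⊗ idMat 2) i j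
      ≡⟨ cong₂ (λ p q → U t δ (suc n) * p - δ * U t δ n * q) (cayley-hamilton i j) (⊗-identityʳ A i j) ⟩
    U t δ (suc n) * (t * A i j - δ * idMat 2 i j) - δ * U t δ n * A i j
      ≡⟨ solve 6 (λ X Y t δ x z → X :* (t :* x :- δ :* z) :- δ :* Y :* x
                                  := (t :* X :- δ :* Y) :* x :- δ :* X :* z) refl
               (U t δ (suc n)) (U t δ n) t δ (A i j) (idMat 2 i j) ⟩
    U t δ (suc (suc n)) * A i j - δ * U t δ (suc n) * idMat 2 i j ∎
    where open ≡-Reasoning

  trace-pow₅ : trace (matPow A 5) ≡ t * t * t * t * t - ι (+ 5) * δ * (t * t * t) + ι (+ 5) * (δ * δ) * t
  trace-pow₅ = begin
    trace (matPow A 5)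
      ≡⟨ cong₂ _+_ (pow≡U 4 0F 0F) (pow≡U 4 1F 1F) ⟩
    (U t δ 5 * A 0F 0F - δ * U t δ 4 * 1ℚ) + (U t δ 5 * A 1F 1F - δ * U t δ 4 * 1ℚ)
      ≡⟨ solve 3 (λ a e δ → let t = a :+ e in
                   (Uᴾ t δ 5 :* a :- δ :* Uᴾ t δ 4 :* con 1ℚ) :+ (Uᴾ t δ 5 :* e :- δ :* Uᴾ t δ 4 :* con 1ℚ)
                   := t :* t :* t :* t :* t :- con (ι (+ 5)) :* δ :* (t :* t :* t)
                        :+ con (ι (+ 5)) :* (δ :* δ) :* t) refl (A 0F 0F) (A 1F 1F) δ ⟩
    t * t * t * t * t - ι (+ 5) * δ * (t * t * t) + ι (+ 5) * (δ * δ) * t ∎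
    where open ≡-Reasoning

  pow₉ : ∀ i j → matPow A 9 i j ≡ (t * t - (δ + δ)) * matPow A 7 i j - δ * δ * matPow A 5 i j
  pow₉ i j = begin
    matPow A 9 i j
      ≡⟨ pow≡U 8 i j ⟩
    U t δ 9 * A i j - δ * U t δ 8 * idMat 2 i j
      ≡⟨ solve 4 (λ t δ x z → Uᴾ t δ 9 :* x :- δ :* Uᴾ t δ 8 :* z
                   := (t :* t :- (δ :+ δ)) :* (Uᴾ t δ 7 :* x :- δ :* Uᴾ t δ 6 :* z)
                        :- δ :* δ :* (Uᴾ t δ 5 :* x :- δ :* Uᴾ t δ 4 :* z))
                 refl t δ (A i j) (idMat 2 i j) ⟩
    (t * t - (δ + δ)) * (U t δ 7 * A i j - δ * U t δ 6 * idMat 2 i j)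
      - δ * δ * (U t δ 5 * A i j - δ * U t δ 4 * idMat 2 i j)
      ≡⟨ sym (cong₂ (λ p q → (t * t - (δ + δ)) * p - δ * δ * q) (pow≡U 6 i j) (pow≡U 4 i j)) ⟩
    (t * t - (δ + δ)) * matPow A 7 i j - δ * δ * matPow A 5 i j ∎
    where open ≡-Reasoning

  trace-pow₅-coeffs : List ℚ
  trace-pow₅-coeffs = - trace (matPow A 5) ∷ ι (+ 5) * (δ * δ) ∷ 0ℚ ∷ - (ι (+ 5) * δ) ∷ 0ℚ ∷ []

  trace-root : monic trace-pow₅-coeffs t ≡ 0ℚ
  trace-root = trans
    (cong (λ T → monic (- T ∷ ι (+ 5) * (δ * δ) ∷ 0ℚ ∷ - (ι (+ 5) * δ) ∷ 0ℚ ∷ []) t) trace-pow₅)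
    (solve 2 (λ t δ →
        :- (t :* t :* t :* t :* t :- con (ι (+ 5)) :* δ :* (t :* t :* t) :+ con (ι (+ 5)) :* (δ :* δ) :* t)
          :+ t :* (con (ι (+ 5)) :* (δ :* δ) :+ t :* (con 0ℚ :+ t :* (:- (con (ι (+ 5)) :* δ)
          :+ t :* (con 0ℚ :+ t :* con 1ℚ))))
        := con 0ℚ) refl t δ)

integral-entry : ∀ {d} (M : Mat d) → IsIntegerMat M → ∀ i j → Integral (M i j)
integral-entry M iM i j = integral (iM i j)

det-integral : ∀ M → IsIntegerMat M → Integral (det M)
det-integral M iM = integral-- (integral-* (m 0F 0F) (m 1F 1F)) (integral-* (m 0F 1F) (m 1F 0F))
  where m = integral-entry M iM

trace-integral : ∀ M → IsIntegerMat M → Integral (trace M)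
trace-integral M iM = integral-+ (integral-entry M iM 0F 0F) (integral-entry M iM 1F 1F)

pow₉-integral₂ : (A : Mat 2) → IsIntegerMat (matPow A 5) → IsIntegerMat (matPow A 7) →
                 IsIntegerMat (matPow A 9)
pow₉-integral₂ A iA⁵ iA⁷ i j = isInteger (subst Integral (sym (pow₉ A i j))
    (integral-- (integral-* iτ (integral-entry (matPow A 7) iA⁷ i j))
                (integral-* (integral-* iδ iδ) (integral-entry (matPow A 5) iA⁵ i j))))
  where
  t = trace A
  δ = det A

  iδ : Integral δ
  iδ = integral-^⇒integral 4 (subst Integral (det-pow A 5) (det-integral (matPow A 5) iA⁵))

  it : Integral t
  it = monicRoot⇒integral
    (integral-neg (trace-integral (matPow A 5) iA⁵) ∷ integral-* i5 (integral-* iδ iδ) ∷ ι-integral 0ℤ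
      ∷ integral-neg (integral-* i5 iδ) ∷ ι-integral 0ℤ ∷ [])
    (trace-root A)
    where i5 = ι-integral (+ 5)

  iτ : Integral (t * t - (δ + δ))
  iτ = integral-- (integral-* it it) (integral-+ iδ iδ)

pow≡^ : ∀ (A : Mat 1) n → matPow A n 0F 0F ≡ A 0F 0F ^ n
pow≡^ A zero    = refl
pow≡^ A (suc n) = trans (ℚ.+-identityʳ _) (cong (A 0F 0F *_) (pow≡^ A n))

pow₉-integral₁ : (A : Mat 1) → IsIntegerMat (matPow A 5) → IsIntegerMat (matPow A 7) →
                 IsIntegerMat (matPow A 9)
pow₉-integral₁ A iA⁵ _ 0F 0F = isInteger (subst Integral (sym (pow≡^ A 9)) (integral-^ ia 9))
  where
  ia : Integral (A 0F 0F)
  ia = integral-^⇒integral 4 (subst Integral (pow≡^ A 5) (integral-entry (matPow A 5) iA⁵ 0F 0F))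

¬Realizes-S : ∀ {d} (A : Mat d) →
              (IsIntegerMat (matPow A 5) → IsIntegerMat (matPow A 7) → IsIntegerMat (matPow A 9)) →
              ¬ Realizes A S
¬Realizes-S A pow₉-integral R =
  9∉S (Equivalence.from (R 9) (pow₉-integral (Equivalence.to (R 5) 5∈S) (Equivalence.to (R 7) 7∈S)))
  where
  9∉S : ¬ S 9
  9∉S ()

S-notDim≤2 : ¬ MatDimAtMost 2 S
S-notDim≤2 (0 , () , _)
S-notDim≤2 (1 , _ , _ , A , R) = ¬Realizes-S A (pow₉-integral₁ A) R
S-notDim≤2 (2 , _ , _ , A , R) = ¬Realizes-S A (pow₉-integral₂ A) R
S-notDim≤2 (suc (suc (suc _)) , _ , s≤s (s≤s ()) , _)

theorem7p4 : Σ SubsetOfℕ (λ S → IsNumericalSemigroup S × PPMAvoiding S × ¬ MatDimAtMost 2 S)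
    × ¬ (∀ (S : SubsetOfℕ) → IsNumericalSemigroup S → AllNonzeroSmallLonely S → Dim2Realizable S)
theorem7p4 =
    (S , S-isNumericalSemigroup , S-ppmAvoiding , S-notDim≤2)
  , λ lonely⇒dim≤2 → S-notDim≤2 (lonely⇒dim≤2 S S-isNumericalSemigroup S-smallLonely)
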